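{- Let $X=MD(G,S_0,S_1,T_0,T_1)$ be max-$\lambda$ but not super-$\lambda$, and let $A$ be a $\lambda$-superatom of $X$. Then $|A|\geq\delta(X)$.
   Context: $G$ is a finite group with identity $1_G$, $S_0,S_1\subseteq G\setminus\{1_G\}$, $T_0,T_1\subseteq G$. The mixed Cayley digraph $X=MD(G,S_0,S_1,T_0,T_1)$ has vertex set $G\times\{0,1\}$ and arcs $((g,i),(sg,i))$ for $g\in G$, $s\in S_i$, $i=0,1$; $((g,0),(tg,1))$ for $g\in G$, $t\in T_0$; and $((tg,1),(g,0))$ for $g\in G$, $t\in T_1$. $\delta(X)$ is the minimum over all vertices of all in-degrees and out-degrees; $\lambda(X)$ is the arc-connectivity (minimum number of arcs whose removal leaves a non-strongly-connected digraph). For $A\subseteq V(X)$, $\omega^+(A)$ (resp. $\omega^-(A)$) is the set of arcs from $A$ to $V(X)\setminus A$ (resp. from $V(X)\setminus A$ to $A$). A proper nonempty $A$ is a positive (resp. negative) arc fragment if $|\omega^+(A)|=\lambda(X)$ (resp. $|\omega^-(A)|=\lambda(X)$); an arc fragment is either of these. A $\lambda$-superatom is an arc fragment with at least two vertices of least possible cardinality among such. $X$ is max-$\lambda$ if $\lambda(X)=\delta(X)$, and super-$\lambda$ if every minimum cut (a set $\omega^+(A)$, $A$ proper nonempty, of cardinality $\lambda(X)$) is the set of all inarcs of some vertex or the set of all outarcs of some vertex. -}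

module Defs where

open import Data.Nat using (ℕ; zero; suc; _+_; _*_; _≤_; _<_; _⊓_)
open import Data.Bool using (Bool; true; false; _∧_; not)
open import Data.Fin using (Fin)
open import Data.Fin.Subset using (Subset)
open import Data.Vec using (lookup)
open import Data.List using (List; []; _∷_; map; _++_; foldr; concatMap; allFin)
open import Data.Product using (_×_; _,_; ∃; Σ)
open import Data.Sum using (_⊎_)
open import Relation.Binary.PropositionalEquality using (_≡_)
open import Relation.Binary.Construct.Closure.ReflexiveTransitive using (Star)
open import Relation.Nullary using (¬_)
open import Algebra.Structures using (IsGroup)
open import Function.Bundles using (_⇔_)

-- A finite group, presented (up to isomorphism) with carrier Fin n,
-- together with the data S₀, S₁ ⊆ G ∖ {1}, T₀, T₁ ⊆ G of a mixed Cayley digraph.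
record MCData (n : ℕ) : Set where
  field
    _∙_     : Fin n → Fin n → Fin n
    ε       : Fin n
    _⁻¹     : Fin n → Fin n
    isGroup : IsGroup _≡_ _∙_ ε _⁻¹
    S₀ S₁ T₀ T₁ : Subset n
    S₀-no-id : lookup S₀ ε ≡ false
    S₁-no-id : lookup S₁ ε ≡ false

-- Vertices G × {0,1}; layer 0 is encoded as false, layer 1 as true.
Vertex : ℕ → Set
Vertex n = Fin n × Bool

count : {A : Set} → (A → Bool) → List A → ℕ
count p [] = 0
count p (x ∷ xs) with p x
... | true  = suc (count p xs)
... | false = count p xs

vertices : (n : ℕ) → List (Vertex n)
vertices n = map (λ g → g , false) (allFin n) ++ map (λ g → g , true) (allFin n)

pairs : (n : ℕ) → List (Vertex n × Vertex n)
pairs n = concatMap (λ u → map (λ v → u , v) (vertices n)) (vertices n)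

Digraph : ℕ → Set
Digraph n = Vertex n → Vertex n → Bool

module _ {n : ℕ} (X : MCData n) where
  open MCData X

  -- arcs of MD(G,S₀,S₁,T₀,T₁):
  --   ((g,0),(sg,0)) s∈S₀ ; ((g,1),(sg,1)) s∈S₁ ;
  --   ((g,0),(tg,1)) t∈T₀ ; ((tg,1),(g,0)) t∈T₁.
  -- In each case, an arc (h₁,i) → (h₂,j) has "label" h₂ h₁⁻¹ (resp. h₁ h₂⁻¹ for T₁).
  MD : Digraph n
  MD (g , false) (h , false) = lookup S₀ (h ∙ (g ⁻¹))
  MD (g , true)  (h , true)  = lookup S₁ (h ∙ (g ⁻¹))
  MD (g , false) (h , true)  = lookup T₀ (h ∙ (g ⁻¹))
  MD (h , true)  (g , false) = lookup T₁ (h ∙ (g ⁻¹))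

outdeg : {n : ℕ} → Digraph n → Vertex n → ℕ
outdeg {n} D u = count (λ v → D u v) (vertices n)

indeg : {n : ℕ} → Digraph n → Vertex n → ℕ
indeg {n} D v = count (λ u → D u v) (vertices n)

-- δ: minimum over all vertices of all in- and out-degrees
-- (the start value 2n is an upper bound of every degree and the vertex list is nonempty)
δ : {n : ℕ} → Digraph n → ℕ
δ {n} D = foldr _⊓_ (n + n) (map (indeg D) (vertices n) ++ map (outdeg D) (vertices n))

Reach : {n : ℕ} → Digraph n → Vertex n → Vertex n → Set
Reach D = Star (λ u v → D u v ≡ true)

StronglyConnected : {n : ℕ} → Digraph n → Set
StronglyConnected D = ∀ u v → Reach D u v

_∖ᵃ_ : {n : ℕ} → Digraph n → (Vertex n → Vertex n → Bool) → Digraph n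
(D ∖ᵃ F) u v = D u v ∧ not (F u v)

removedCount : {n : ℕ} → Digraph n → (Vertex n → Vertex n → Bool) → ℕ
removedCount {n} D F = count (λ { (u , v) → D u v ∧ F u v }) (pairs n)

IsArcConnectivity : {n : ℕ} → Digraph n → ℕ → Set
IsArcConnectivity D k =
  (Σ _ λ F → removedCount D F ≡ k × ¬ StronglyConnected (D ∖ᵃ F))
  × (∀ F → removedCount D F < k → StronglyConnected (D ∖ᵃ F))

VSet : ℕ → Set
VSet n = Vertex n → Bool

card : {n : ℕ} → VSet n → ℕ
card {n} A = count A (vertices n)

ProperNonempty : {n : ℕ} → VSet n → Set
ProperNonempty A = (∃ λ v → A v ≡ true) × (∃ λ v → A v ≡ false)

ωout : {n : ℕ} → Digraph n → VSet n → Vertex n → Vertex n → Bool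
ωout D A u v = A u ∧ not (A v) ∧ D u v

ωin : {n : ℕ} → Digraph n → VSet n → Vertex n → Vertex n → Bool
ωin D A u v = not (A u) ∧ A v ∧ D u v

arcCount : {n : ℕ} → (Vertex n → Vertex n → Bool) → ℕ
arcCount {n} R = count (λ { (u , v) → R u v }) (pairs n)

IsArcFragment : {n : ℕ} → Digraph n → ℕ → VSet n → Set
IsArcFragment D λ' A = ProperNonempty A × (arcCount (ωout D A) ≡ λ' ⊎ arcCount (ωin D A) ≡ λ')

IsLambdaSuperatom : {n : ℕ} → Digraph n → ℕ → VSet n → Set
IsLambdaSuperatom D λ' A =
  IsArcFragment D λ' A × 2 ≤ card A
  × (∀ B → IsArcFragment D λ' B → 2 ≤ card B → card A ≤ card B)

IsMaxLambda : {n : ℕ} → Digraph n → ℕ → Set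
IsMaxLambda D λ' = λ' ≡ δ D

IsSuperLambda : {n : ℕ} → Digraph n → ℕ → Set
IsSuperLambda D λ' =
  ∀ A → ProperNonempty A → arcCount (ωout D A) ≡ λ' →
    (∃ λ w → ∀ u v → (ωout D A u v ≡ true) ⇔ (D u v ≡ true × v ≡ w))
    ⊎ (∃ λ w → ∀ u v → (ωout D A u v ≡ true) ⇔ (D u v ≡ true × u ≡ w))

module Submission where

open import Defs
open import Data.Nat using (ℕ; zero; suc; _+_; _*_; _≤_; _<_; _⊓_; z≤n; s≤s)
open import Relation.Nullary using (¬_)
open import Data.Nat.Properties
open import Data.Bool using (Bool; true; false; _∧_; not)
open import Data.Vec using (lookup)
open import Data.List using (List; []; _∷_; map; _++_; foldr; concatMap; allFin)
open import Data.List.Membership.Propositional using (_∈_)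
open import Data.List.Relation.Unary.Any using (here; there)
open import Data.List.Membership.Propositional.Properties using (∈-map⁺; ∈-++⁺ˡ; ∈-++⁺ʳ; ∈-allFin)
open import Data.Product using (_,_)
open import Data.Sum using (inj₁; inj₂)
open import Relation.Binary.PropositionalEquality
open import Algebra.Structures using (IsGroup)
open import Algebra.Properties.CommutativeSemigroup +-commutativeSemigroup using (interchange)
open import Function using (_∘_)
open import Data.Nat.Solver using (module +-*-Solver)
open +-*-Solver using (solve; _:+_; _:*_; _:=_; con)

-- A λ-superatom A is in particular an arc fragment with |A| ≥ 2, and that is all
-- the argument uses.  Say |ω⁺(A)| = λ = δ.  Every u ∈ A has out-degree ≥ δ, and,
-- the digraph being loopless, at most |A| − 1 of those arcs stay inside A; so
-- summing over A gives |A|(δ − |A| + 1) ≤ |ω⁺(A)| = δ, which for |A| ≥ 2 forces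
-- δ ≤ |A|.  Negative fragments are positive fragments of the reversed digraph.

𝟙 : Bool → ℕ
𝟙 true  = 1
𝟙 false = 0

∑ : {B : Set} → (B → ℕ) → List B → ℕ
∑ f []       = 0
∑ f (x ∷ xs) = f x + ∑ f xs

private variable B C : Set

count≡∑𝟙 : (p : B → Bool) (xs : List B) → count p xs ≡ ∑ (𝟙 ∘ p) xs
count≡∑𝟙 p [] = refl
count≡∑𝟙 p (x ∷ xs) with p x
... | true  = cong suc (count≡∑𝟙 p xs)
... | false = count≡∑𝟙 p xs

∑-++ : (f : B → ℕ) (xs ys : List B) → ∑ f (xs ++ ys) ≡ ∑ f xs + ∑ f ys
∑-++ f [] ys = refl
∑-++ f (x ∷ xs) ys = trans (cong (f x +_) (∑-++ f xs ys)) (sym (+-assoc (f x) _ _))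

∑-map : (f : C → ℕ) (h : B → C) (xs : List B) → ∑ f (map h xs) ≡ ∑ (f ∘ h) xs
∑-map f h [] = refl
∑-map f h (x ∷ xs) = cong (f (h x) +_) (∑-map f h xs)

∑-concatMap : (f : C → ℕ) (g : B → List C) (xs : List B) →
  ∑ f (concatMap g xs) ≡ ∑ (∑ f ∘ g) xs
∑-concatMap f g [] = refl
∑-concatMap f g (x ∷ xs) =
  trans (∑-++ f (g x) (concatMap g xs)) (cong (∑ f (g x) +_) (∑-concatMap f g xs))

∑-cong : {f g : B → ℕ} → (∀ x → f x ≡ g x) → (xs : List B) → ∑ f xs ≡ ∑ g xs
∑-cong f≗g [] = refl
∑-cong f≗g (x ∷ xs) = cong₂ _+_ (f≗g x) (∑-cong f≗g xs)

∑-0 : (xs : List B) → ∑ (λ _ → 0) xs ≡ 0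
∑-0 [] = refl
∑-0 (x ∷ xs) = ∑-0 xs

∑-+ : (f g : B → ℕ) (xs : List B) → ∑ (λ x → f x + g x) xs ≡ ∑ f xs + ∑ g xs
∑-+ f g [] = refl
∑-+ f g (x ∷ xs) = trans (cong (f x + g x +_) (∑-+ f g xs)) (interchange (f x) (g x) _ _)

∑-comm : (f : B → C → ℕ) (xs : List B) (ys : List C) →
  ∑ (λ x → ∑ (f x) ys) xs ≡ ∑ (λ y → ∑ (λ x → f x y) xs) ys
∑-comm f [] ys = sym (∑-0 ys)
∑-comm f (x ∷ xs) ys = trans (cong (∑ (f x) ys +_) (∑-comm f xs ys))
  (sym (∑-+ (f x) (λ y → ∑ (λ x → f x y) xs) ys))

∑-mono-≤ : {f g : B → ℕ} → (∀ x → f x ≤ g x) → (xs : List B) → ∑ f xs ≤ ∑ g xs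
∑-mono-≤ f≤g [] = z≤n
∑-mono-≤ f≤g (x ∷ xs) = +-mono-≤ (f≤g x) (∑-mono-≤ f≤g xs)

∑-mono-< : {f g : B → ℕ} → (∀ x → f x ≤ g x) → {u : B} {xs : List B} → u ∈ xs →
  f u < g u → ∑ f xs < ∑ g xs
∑-mono-< f≤g {xs = x ∷ xs} (here refl) fu<gu = +-mono-<-≤ fu<gu (∑-mono-≤ f≤g xs)
∑-mono-< f≤g {xs = x ∷ xs} (there u∈xs) fu<gu = +-mono-≤-< (f≤g x) (∑-mono-< f≤g u∈xs fu<gu)

-- d < g x + a encodes g x ≥ d + 1 − a without truncated subtraction.
count*-≤-∑+count* : (p : B → Bool) (g : B → ℕ) {a d : ℕ} →
  (∀ x → p x ≡ true → d < g x + a) → (xs : List B) →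
  count p xs * suc d ≤ ∑ g xs + count p xs * a
count*-≤-∑+count* p g bound [] = z≤n
count*-≤-∑+count* p g {a} bound (x ∷ xs) with p x in px
... | true  = ≤-trans (+-mono-≤ (bound x px) (count*-≤-∑+count* p g bound xs))
                (≤-reflexive (interchange (g x) a (∑ g xs) _))
... | false = ≤-trans (count*-≤-∑+count* p g bound xs)
                (≤-trans (m≤n+m _ (g x)) (≤-reflexive (sym (+-assoc (g x) _ _))))

foldr-⊓-≤-∈ : ∀ {x z} {xs : List ℕ} → x ∈ xs → foldr _⊓_ z xs ≤ x
foldr-⊓-≤-∈ {xs = y ∷ xs} (here refl) = m⊓n≤m y _
foldr-⊓-≤-∈ {xs = y ∷ xs} (there x∈xs) = ≤-trans (m⊓n≤n y _) (foldr-⊓-≤-∈ x∈xs)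

≤-from-a*suc[d]≤d+a*a : ∀ a d → 2 ≤ a → a * suc d ≤ d + a * a → d ≤ a
≤-from-a*suc[d]≤d+a*a a@(suc b@(suc _)) d (s≤s (s≤s z≤n)) le =
  *-cancelˡ-≤ b (+-cancelʳ-≤ a _ _ (+-cancelˡ-≤ d _ _ (begin
    d + (b * d + a)  ≡⟨ expand-lhs b d ⟩
    a * suc d        ≤⟨ le ⟩
    d + a * a        ≡⟨ expand-rhs b d ⟩
    d + (b * a + a)  ∎)))
  where
  open ≤-Reasoning
  expand-lhs : ∀ b d → d + (b * d + suc b) ≡ suc b * suc d
  expand-lhs = solve 2 (λ b d → d :+ (b :* d :+ (con 1 :+ b))
                              := (con 1 :+ b) :* (con 1 :+ d)) refl
  expand-rhs : ∀ b d → d + suc b * suc b ≡ d + (b * suc b + suc b)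
  expand-rhs = solve 2 (λ b d → d :+ (con 1 :+ b) :* (con 1 :+ b)
                              := d :+ (b :* (con 1 :+ b) :+ (con 1 :+ b))) refl

Loopless : {n : ℕ} → Digraph n → Set
Loopless D = ∀ u → D u u ≡ false

_ᵀ : {n : ℕ} → Digraph n → Digraph n
(D ᵀ) u v = D v u

module _ {n : ℕ} where

  private
    V : List (Vertex n)
    V = vertices n

  ∈-vertices : (u : Vertex n) → u ∈ vertices n
  ∈-vertices (g , false) = ∈-++⁺ˡ (∈-map⁺ (λ g → g , false) (∈-allFin g))
  ∈-vertices (g , true)  =
    ∈-++⁺ʳ (map (λ g → g , false) (allFin n)) (∈-map⁺ (λ g → g , true) (∈-allFin g))

  δ≤outdeg : (D : Digraph n) (u : Vertex n) → δ D ≤ outdeg D u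
  δ≤outdeg D u = foldr-⊓-≤-∈ (∈-++⁺ʳ (map (indeg D) V) (∈-map⁺ (outdeg D) (∈-vertices u)))

  δ≤indeg : (D : Digraph n) (u : Vertex n) → δ D ≤ indeg D u
  δ≤indeg D u = foldr-⊓-≤-∈ (∈-++⁺ˡ (∈-map⁺ (indeg D) (∈-vertices u)))

  arcCount≡∑∑ : (R : Vertex n → Vertex n → Bool) →
    arcCount R ≡ ∑ (λ u → ∑ (𝟙 ∘ R u) V) V
  arcCount≡∑∑ R = begin
    arcCount R                                            ≡⟨ count≡∑𝟙 _ (pairs n) ⟩
    ∑ _ (concatMap (λ u → map (u ,_) V) V)                ≡⟨ ∑-concatMap _ (λ u → map (u ,_) V) V ⟩
    ∑ (λ u → ∑ _ (map (u ,_) V)) V                        ≡⟨ ∑-cong (λ u → ∑-map _ (u ,_) V) V ⟩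
    ∑ (λ u → ∑ (𝟙 ∘ R u) V) V                             ∎
    where open ≡-Reasoning

  arcCount-ωin≡ωout-ᵀ : (D : Digraph n) (A : VSet n) →
    arcCount (ωin D A) ≡ arcCount (ωout (D ᵀ) A)
  arcCount-ωin≡ωout-ᵀ D A = begin
    arcCount (ωin D A)                                  ≡⟨ arcCount≡∑∑ _ ⟩
    ∑ (λ u → ∑ (𝟙 ∘ ωin D A u) V) V                     ≡⟨ ∑-comm _ V V ⟩
    ∑ (λ v → ∑ (λ u → 𝟙 (ωin D A u v)) V) V             ≡⟨ ∑-cong (λ v → ∑-cong (λ u → swap (A u) (A v) (D u v)) V) V ⟩
    ∑ (λ v → ∑ (𝟙 ∘ ωout (D ᵀ) A v) V) V                ≡⟨ arcCount≡∑∑ _ ⟨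
    arcCount (ωout (D ᵀ) A)                             ∎
    where
    open ≡-Reasoning
    swap : ∀ a b c → 𝟙 (not a ∧ b ∧ c) ≡ 𝟙 (b ∧ not a ∧ c)
    swap true  true  c = refl
    swap true  false c = refl
    swap false true  c = refl
    swap false false c = refl

  module _ (D : Digraph n) (A : VSet n) where

    arcsOutOf arcsInto : Vertex n → ℕ
    arcsOutOf u = ∑ (λ v → 𝟙 (not (A v) ∧ D u v)) V
    arcsInto  u = ∑ (λ v → 𝟙 (A v ∧ D u v)) V

    outdeg≡arcsOutOf+arcsInto : ∀ u → outdeg D u ≡ arcsOutOf u + arcsInto u
    outdeg≡arcsOutOf+arcsInto u =
      trans (count≡∑𝟙 (D u) V) (trans (∑-cong (λ v → split (A v) (D u v)) V) (∑-+ _ _ V))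
      where
      split : ∀ a b → 𝟙 b ≡ 𝟙 (not a ∧ b) + 𝟙 (a ∧ b)
      split true  b = refl
      split false b = sym (+-identityʳ (𝟙 b))

    arcsInto<card : Loopless D → ∀ u → A u ≡ true → arcsInto u < card A
    arcsInto<card loopless u Au = subst (arcsInto u <_) (sym (count≡∑𝟙 A V))
      (∑-mono-< (λ v → ∧-≤ (A v) (D u v)) (∈-vertices u) no-loop)
      where
      ∧-≤ : ∀ a b → 𝟙 (a ∧ b) ≤ 𝟙 a
      ∧-≤ true  true  = ≤-refl
      ∧-≤ true  false = z≤n
      ∧-≤ false b     = z≤n
      no-loop : 𝟙 (A u ∧ D u u) < 𝟙 (A u)
      no-loop rewrite Au | loopless u = s≤s z≤n

    outdeg<ωout+card : Loopless D → ∀ u → A u ≡ true →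
      outdeg D u < ∑ (𝟙 ∘ ωout D A u) V + card A
    outdeg<ωout+card loopless u Au = begin-strict
      outdeg D u                   ≡⟨ outdeg≡arcsOutOf+arcsInto u ⟩
      arcsOutOf u + arcsInto u     <⟨ +-monoʳ-< (arcsOutOf u) (arcsInto<card loopless u Au) ⟩
      arcsOutOf u + card A         ≡⟨ cong (_+ card A) (∑-cong (λ v → cong (λ b → 𝟙 (b ∧ not (A v) ∧ D u v)) (sym Au)) V) ⟩
      ∑ (𝟙 ∘ ωout D A u) V + card A ∎
      where open ≤-Reasoning

    card*suc-≤-ωout+card*card : Loopless D → {d : ℕ} → (∀ u → d ≤ outdeg D u) →
      card A * suc d ≤ arcCount (ωout D A) + card A * card A
    card*suc-≤-ωout+card*card loopless deg = subst (λ c → _ ≤ c + _) (sym (arcCount≡∑∑ _))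
      (count*-≤-∑+count* A _ (λ u Au → ≤-<-trans (deg u) (outdeg<ωout+card loopless u Au)) V)

    d≤card-of-small-cut : Loopless D → {d : ℕ} → (∀ u → d ≤ outdeg D u) →
      2 ≤ card A → arcCount (ωout D A) ≤ d → d ≤ card A
    d≤card-of-small-cut loopless {d} deg 2≤|A| cut≤d =
      ≤-from-a*suc[d]≤d+a*a (card A) d 2≤|A|
        (≤-trans (card*suc-≤-ωout+card*card loopless deg) (+-monoˡ-≤ _ cut≤d))

MD-loopless : {n : ℕ} (X : MCData n) → Loopless (MD X)
MD-loopless X (g , false) = trans (cong (lookup S₀) (inverseʳ g)) S₀-no-id
  where open MCData X; open IsGroup isGroup using (inverseʳ)
MD-loopless X (g , true)  = trans (cong (lookup S₁) (inverseʳ g)) S₁-no-id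
  where open MCData X; open IsGroup isGroup using (inverseʳ)

lemma4p3 : {n : ℕ} (X : MCData n) (λX : ℕ) → IsArcConnectivity (MD X) λX →
    IsMaxLambda (MD X) λX → ¬ IsSuperLambda (MD X) λX →
    (A : VSet n) → IsLambdaSuperatom (MD X) λX A → δ (MD X) ≤ card A
lemma4p3 X _ _ λ≡δ _ A ((_ , inj₁ ω⁺≡λ) , 2≤|A| , _) =
  d≤card-of-small-cut (MD X) A (MD-loopless X) (δ≤outdeg (MD X)) 2≤|A|
    (≤-reflexive (trans ω⁺≡λ λ≡δ))
lemma4p3 X _ _ λ≡δ _ A ((_ , inj₂ ω⁻≡λ) , 2≤|A| , _) =
  d≤card-of-small-cut (MD X ᵀ) A (MD-loopless X) (δ≤indeg (MD X)) 2≤|A|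
    (≤-reflexive (trans (sym (arcCount-ωin≡ωout-ᵀ (MD X) A)) (trans ω⁻≡λ λ≡δ)))
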